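{- Let $G$ be a finite connected graph and $k\geq 1$ an integer, and let $\mathcal{E}_k$ be the scramble on $G$ whose eggs are exactly the connected subsets of $V(G)$ with exactly $k$ vertices. Then $e(\mathcal{E}_k)=\lambda_k(G)$.
   Context: Graphs are finite, connected, undirected multigraphs without loops. For $A,B\subseteq V(G)$, $E(A,B)$ is the multiset of edges with one endpoint in $A$ and the other in $B$. A set $S\subseteq V(G)$ is connected if $G[S]$ is connected. For $k\geq1$, $\lambda_k(G)$ is the minimum size of a multiset $T\subseteq E(G)$ such that $G-T$ is disconnected and every connected component of $G-T$ has at least $k$ vertices; $\lambda_k(G)=\infty$ if no such $T$ exists. A scramble is a collection of nonempty connected subsets (eggs). An egg-cut is a set $A\subseteq V(G)$ such that both $A$ and $A^C$ contain an egg; its size is $|E(A,A^C)|$; $e(\mathcal{S})$ is the minimum size of an egg-cut ($\infty$ if none exists). -}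

module Defs where

open import Data.Nat using (ℕ; zero; suc; _+_; _≤_)
open import Data.Fin using (Fin; zero; suc)
open import Data.Bool using (Bool; true; false; _xor_)
open import Data.Product using (Σ; _×_; _,_; ∃; proj₁; proj₂)
open import Data.Sum using (_⊎_)
open import Data.Maybe using (Maybe; just; nothing)
open import Data.Unit using (⊤)
open import Relation.Binary.PropositionalEquality using (_≡_; _≢_)
open import Relation.Nullary using (¬_)
open import Function.Definitions using (Injective)

-- A finite loopless multigraph: vertices Fin n, edges indexed by Fin m,
-- edge i has endpoints ends i (ordered pair, read as unordered).
record Graph : Set where
  field
    n      : ℕ
    m      : ℕ
    ends   : Fin m → Fin n × Fin n
    loopless : ∀ i → proj₁ (ends i) ≢ proj₂ (ends i)
open Graph public

count : ∀ {k} → (Fin k → Bool) → ℕ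
count {zero} f = 0
count {suc k} f with f zero
... | true  = suc (count (λ i → f (suc i)))
... | false = count (λ i → f (suc i))

Joins : (G : Graph) → Fin (m G) → Fin (n G) → Fin (n G) → Set
Joins G i u w = (ends G i ≡ (u , w)) ⊎ (ends G i ≡ (w , u))

data Walk (G : Graph) (allowed : Fin (m G) → Set) (S : Fin (n G) → Bool)
          : Fin (n G) → Fin (n G) → Set where
  here : ∀ {u} → S u ≡ true → Walk G allowed S u u
  step : ∀ {u w v} (i : Fin (m G)) → allowed i → Joins G i u w →
         S u ≡ true → Walk G allowed S w v → Walk G allowed S u v

AllEdges : (G : Graph) → Fin (m G) → Set
AllEdges G i = ⊤

AllVerts : (G : Graph) → Fin (n G) → Bool
AllVerts G v = true

ConnectedGraph : Graph → Set
ConnectedGraph G = Fin (n G) ×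
  (∀ u v → Walk G (AllEdges G) (AllVerts G) u v)

ConnectedSet : (G : Graph) → (Fin (n G) → Bool) → Set
ConnectedSet G S = (Σ (Fin (n G)) λ v → S v ≡ true) ×
  (∀ u v → S u ≡ true → S v ≡ true → Walk G (AllEdges G) S u v)

EggE : (G : Graph) → ℕ → (Fin (n G) → Bool) → Set
EggE G k S = ConnectedSet G S × count S ≡ k

_⊆_ : ∀ {k} → (Fin k → Bool) → (Fin k → Bool) → Set
S ⊆ A = ∀ v → S v ≡ true → A v ≡ true

complement : ∀ {k} → (Fin k → Bool) → (Fin k → Bool)
complement A v with A v
... | true = false
... | false = true

cutSize : (G : Graph) → (Fin (n G) → Bool) → ℕ
cutSize G A = count (λ i → A (proj₁ (ends G i)) xor A (proj₂ (ends G i)))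

IsEggCut : (G : Graph) → ((Fin (n G) → Bool) → Set) → (Fin (n G) → Bool) → Set
IsEggCut G Egg A =
  (Σ _ λ S → Egg S × S ⊆ A) × (Σ _ λ S → Egg S × S ⊆ complement A)

EggCutOfSize : (G : Graph) → ((Fin (n G) → Bool) → Set) → ℕ → Set
EggCutOfSize G Egg s = Σ _ λ A → IsEggCut G Egg A × cutSize G A ≡ s

Kept : (G : Graph) → (Fin (m G) → Bool) → Fin (m G) → Set
Kept G T i = T i ≡ false

-- T witnesses λ_k: G - T disconnected, every component has ≥ k vertices.
IsKCut : (G : Graph) → ℕ → (Fin (m G) → Bool) → Set
IsKCut G k T =
  (Σ _ λ u → Σ _ λ v → ¬ Walk G (Kept G T) (AllVerts G) u v) ×
  (∀ v → Σ (Fin k → Fin (n G)) λ f → Injective _≡_ _≡_ f ×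
          (∀ j → Walk G (Kept G T) (AllVerts G) v (f j)))

KCutOfSize : (G : Graph) → ℕ → ℕ → Set
KCutOfSize G k s = Σ _ λ T → IsKCut G k T × count T ≡ s

-- v is the minimum of {s | P s}, with nothing = ∞ (empty set).
IsMin : (ℕ → Set) → Maybe ℕ → Set
IsMin P nothing  = ∀ s → ¬ P s
IsMin P (just s) = P s × (∀ s' → P s' → s ≤ s')

IsEggCutNumber : (G : Graph) → ((Fin (n G) → Bool) → Set) → Maybe ℕ → Set
IsEggCutNumber G Egg = IsMin (EggCutOfSize G Egg)

IsLambda : (G : Graph) → ℕ → Maybe ℕ → Set
IsLambda G k = IsMin (KCutOfSize G k)

-- Both minima are attained at an egg bond: a set D such that D and its
-- complement are connected and each contains an egg.  The boundary of an egg
-- bond D is an egg-cut and also a λ_k-cut, since the components of G − ∂D are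
-- exactly D and Dᶜ.  Conversely, for an egg-cut A let C be the component of
-- G[A] containing one egg and D the component of G[Cᶜ] containing the other:
-- Dᶜ ⊇ C is connected because G is, so D is an egg bond, and ∂D ⊆ ∂C ⊆ ∂A.
-- A λ_k-cut T yields such an egg-cut: the component of G − T at a vertex has
-- at least k vertices, hence contains a connected set of exactly k vertices
-- (grow one vertex at a time), and its boundary lies in T.  Being an egg bond
-- is decidable, so over the finitely many vertex sets either there is none
-- (both values are ∞) or one of least cut size realises both minima.

module Submission where

open import Defs
open import Data.Nat using (ℕ; zero; suc; _≤_; _<_; _≥_; z≤n; s≤s; _<?_)
open import Data.Nat.Properties using (≤-trans; ≤-reflexive; ≤-pred; <⇒≤; m≤n⇒m≤1+n; ≮⇒≥)
  renaming (_≟_ to _≟ℕ_)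
open import Data.Nat.Induction using (<-rec)
open import Data.Fin using (Fin; zero; suc)
open import Data.Fin.Properties using (_≟_; any?; all?; suc-injective)
open import Data.Fin.Subset.Properties using (anySubset?)
open import Data.Vec using (lookup; tabulate)
open import Data.Vec.Properties using (lookup∘tabulate)
open import Data.Bool using (Bool; true; false; _xor_; not; _∨_; if_then_else_)
open import Data.Bool.Properties using (xor-comm; xor-same) renaming (_≟_ to _≟ᴮ_)
open import Data.Product using (Σ; _×_; _,_; ∃; proj₁; proj₂; map)
open import Data.Product.Properties using (≡-dec)
open import Data.Sum using (_⊎_; inj₁; inj₂)
open import Data.Unit using (tt)
open import Data.Maybe using (Maybe; just; nothing)
open import Data.Empty using (⊥; ⊥-elim)
open import Function using (_∘_; id)
open import Function.Definitions using (Injective)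
open import Relation.Binary.Definitions using (_Respects_)
open import Relation.Binary.PropositionalEquality
  using (_≡_; _≢_; refl; sym; trans; cong; cong₂; subst; _≗_; module ≡-Reasoning)
open import Relation.Nullary using (¬_; Dec; yes; no; does; contradiction)
open import Relation.Nullary.Decidable using (_×-dec_; _⊎-dec_; _→-dec_; map′; dec-true; dec-false)
open import Relation.Unary using (Decidable)

-- Vertex and edge sets as Boolean functions

Sub : ℕ → Set
Sub k = Fin k → Bool

empty : ∀ {k} → Sub k
empty _ = false

remove : ∀ {k} → Sub k → Fin k → Sub k
remove S u x = if does (x ≟ u) then false else S x

insert : ∀ {k} → Sub k → Fin k → Sub k
insert S b x = S x ∨ does (x ≟ b)

singleton : ∀ {k} → Fin k → Sub k
singleton = insert empty

clash : ∀ {ℓ} {A : Set ℓ} {b} → b ≡ true → b ≡ false → A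
clash refl ()

module _ {k : ℕ} where

  remove-self : ∀ (S : Sub k) u → remove S u u ≡ false
  remove-self S u rewrite dec-true (u ≟ u) refl = refl

  remove-⊆ : ∀ (S : Sub k) u → remove S u ⊆ S
  remove-⊆ S u x x∈ with x ≟ u
  ... | no _ = x∈

  remove-∈ : ∀ (S : Sub k) {u x} → S x ≡ true → x ≢ u → remove S u x ≡ true
  remove-∈ S {u} {x} x∈S x≢u rewrite dec-false (x ≟ u) x≢u = x∈S

  insert-self : ∀ (S : Sub k) b → insert S b b ≡ true
  insert-self S b rewrite dec-true (b ≟ b) refl with S b
  ... | true = refl
  ... | false = refl

  insert-⊇ : ∀ (S : Sub k) b → S ⊆ insert S b
  insert-⊇ S b x x∈S rewrite x∈S = refl

  insert-∈ : ∀ (S : Sub k) b {x} → insert S b x ≡ true → S x ≡ true ⊎ x ≡ b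
  insert-∈ S b {x} x∈ with S x | x ≟ b
  ... | true | _ = inj₁ refl
  ... | false | yes x≡b = inj₂ x≡b

  insert-⊆ : ∀ {S C : Sub k} {b} → S ⊆ C → C b ≡ true → insert S b ⊆ C
  insert-⊆ {S} {b = b} S⊆C b∈C x x∈ with insert-∈ S b x∈
  ... | inj₁ x∈S = S⊆C x x∈S
  ... | inj₂ refl = b∈C

  singleton-∈ : ∀ {b x : Fin k} → singleton b x ≡ true → x ≡ b
  singleton-∈ {b} x∈ with insert-∈ empty b x∈
  ... | inj₂ x≡b = x≡b

complement-not : ∀ {k} (D : Sub k) x → complement D x ≡ not (D x)
complement-not D x with D x
... | true = refl
... | false = refl

∉⇒∈complement : ∀ {k} {D : Sub k} {x} → D x ≡ false → complement D x ≡ true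
∉⇒∈complement {D = D} {x} x∉D rewrite complement-not D x | x∉D = refl

∈complement⇒∉ : ∀ {k} {D : Sub k} {x} → complement D x ≡ true → D x ≡ false
∈complement⇒∉ {D = D} {x} x∈ with D x | complement-not D x
... | false | _ = refl
... | true | eq = clash x∈ eq

disjoint⇒⊆complement : ∀ {k} {S D : Sub k} → (∀ x → S x ≡ true → D x ≡ true → ⊥) → S ⊆ complement D
disjoint⇒⊆complement {D = D} disjoint x x∈S with D x in x∈D
... | true = ⊥-elim (disjoint x x∈S x∈D)
... | false = refl

complement-cong : ∀ {k} {D D′ : Sub k} → D ≗ D′ → complement D ≗ complement D′
complement-cong {D = D} {D′} eq x = trans (complement-not D x) (trans (cong not (eq x)) (sym (complement-not D′ x)))

xor-true : ∀ {a b} → a xor b ≡ true → (a ≡ true × b ≡ false) ⊎ (a ≡ false × b ≡ true)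
xor-true {true} {false} _ = inj₁ (refl , refl)
xor-true {false} {true} _ = inj₂ (refl , refl)

xor-false : ∀ {a b} → a xor b ≡ false → a ≡ b
xor-false {true} {true} _ = refl
xor-false {false} {false} _ = refl

count-cong : ∀ {k} {S S′ : Sub k} → S ≗ S′ → count S ≡ count S′
count-cong {zero} _ = refl
count-cong {suc k} {S} {S′} S≗S′ with S zero | S′ zero | S≗S′ zero
... | true | .true | refl = cong suc (count-cong (S≗S′ ∘ suc))
... | false | .false | refl = count-cong (S≗S′ ∘ suc)

count-mono : ∀ {k} {S S′ : Sub k} → S ⊆ S′ → count S ≤ count S′
count-mono {zero} _ = z≤n
count-mono {suc k} {S} {S′} S⊆S′ with S zero in e | S′ zero in e′
... | true | true = s≤s (count-mono (S⊆S′ ∘ suc))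
... | false | false = count-mono (S⊆S′ ∘ suc)
... | false | true = m≤n⇒m≤1+n (count-mono (S⊆S′ ∘ suc))
... | true | false = clash (S⊆S′ zero e) e′

count≤ : ∀ {k} (S : Sub k) → count S ≤ k
count≤ {zero} S = z≤n
count≤ {suc k} S with S zero
... | true = s≤s (count≤ (S ∘ suc))
... | false = m≤n⇒m≤1+n (count≤ (S ∘ suc))

count-empty : ∀ {k} → count {k} empty ≡ 0
count-empty {zero} = refl
count-empty {suc k} = count-empty {k}

count<⇒∃ : ∀ {k} (S S′ : Sub k) → count S < count S′ → ∃ λ x → S′ x ≡ true × S x ≡ false
count<⇒∃ {suc k} S S′ lt with S zero in e | S′ zero in e′
... | false | true = zero , e′ , e
... | false | false = map suc id (count<⇒∃ (S ∘ suc) (S′ ∘ suc) lt)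
... | true | true = map suc id (count<⇒∃ (S ∘ suc) (S′ ∘ suc) (≤-pred lt))
... | true | false = map suc id (count<⇒∃ (S ∘ suc) (S′ ∘ suc) (<⇒≤ lt))

count-remove : ∀ {k} (S : Sub k) {u} → S u ≡ true → count S ≡ suc (count (remove S u))
count-remove {suc k} S {zero} u∈S rewrite u∈S = refl
count-remove {suc k} S {suc u} u∈S with S zero
... | true = cong suc (count-remove (S ∘ suc) u∈S)
... | false = count-remove (S ∘ suc) u∈S

count-insert : ∀ {k} (S : Sub k) {b} → S b ≡ false → count (insert S b) ≡ suc (count S)
count-insert S {b} b∉S = begin
  count (insert S b)                    ≡⟨ count-remove (insert S b) (insert-self S b) ⟩
  suc (count (remove (insert S b) b))   ≡⟨ cong suc (count-cong remove-insert) ⟩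
  suc (count S)                         ∎
  where
  open ≡-Reasoning
  remove-insert : remove (insert S b) b ≗ S
  remove-insert x with x ≟ b
  ... | yes refl = sym b∉S
  ... | no _ with S x
  ...   | true = refl
  ...   | false = refl

count-singleton : ∀ {k} (b : Fin k) → count (singleton b) ≡ 1
count-singleton {k} b = trans (count-insert (empty {k}) {b} refl) (cong suc (count-empty {k}))

injection≤count : ∀ {k n} (S : Sub n) (f : Fin k → Fin n) → Injective _≡_ _≡_ f →
                  (∀ j → S (f j) ≡ true) → k ≤ count S
injection≤count {zero} S f _ _ = z≤n
injection≤count {suc k} S f f-inj f∈S rewrite count-remove S (f∈S zero) =
  s≤s (injection≤count (remove S (f zero)) (f ∘ suc) (suc-injective ∘ f-inj) f∈S′)
  where
  f∈S′ : ∀ j → remove S (f zero) (f (suc j)) ≡ true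
  f∈S′ j = remove-∈ S (f∈S (suc j)) (λ eq → contradiction (f-inj eq) λ ())

enumerate : ∀ {n} (S : Sub n) →
            Σ (Fin (count S) → Fin n) λ f → Injective _≡_ _≡_ f × (∀ j → S (f j) ≡ true)
enumerate {zero} S = (λ ()) , (λ { {()} }) , λ ()
enumerate {suc n} S with S zero in e | enumerate (S ∘ suc)
... | false | f , f-inj , f∈S = suc ∘ f , f-inj ∘ suc-injective , f∈S
... | true | f , f-inj , f∈S = f′ , f′-inj , f′∈S
  where
  f′ : Fin (suc (count (S ∘ suc))) → Fin (suc n)
  f′ zero = zero
  f′ (suc j) = suc (f j)
  f′-inj : Injective _≡_ _≡_ f′
  f′-inj {zero} {zero} _ = refl
  f′-inj {suc i} {suc j} eq = cong suc (f-inj (suc-injective eq))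
  f′∈S : ∀ j → S (f′ j) ≡ true
  f′∈S zero = e
  f′∈S (suc j) = f∈S j

count⇒injection : ∀ {n k} {P : Fin n → Set} {S : Sub n} → count S ≡ k → (∀ x → S x ≡ true → P x) →
                  Σ (Fin k → Fin n) λ f → Injective _≡_ _≡_ f × (∀ j → P (f j))
count⇒injection {S = S} refl P-on-S with enumerate S
... | f , f-inj , f∈S = f , f-inj , λ j → P-on-S _ (f∈S j)

-- Searching the finitely many subsets

any-sub? : ∀ {n} {P : Sub n → Set} → P Respects _≗_ → Decidable P → Dec (∃ P)
any-sub? P-cong P? =
  map′ (λ (v , p) → lookup v , p)
       (λ (f , p) → tabulate f , P-cong (sym ∘ lookup∘tabulate f) p)
       (anySubset? (P? ∘ lookup))

minimise : ∀ {n} {P : Sub n → Set} → P Respects _≗_ → Decidable P →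
           (c : Sub n → ℕ) → (∀ {f g} → f ≗ g → c f ≡ c g) →
           ∃ P → Σ (Sub n) λ f → P f × (∀ g → P g → c f ≤ c g)
minimise {n} {P} P-cong P? c c-cong (f , p) = <-rec Goal descend (c f) f refl p
  where
  Goal : ℕ → Set
  Goal b = ∀ f → c f ≡ b → P f → Σ (Sub n) λ g → P g × (∀ h → P h → c g ≤ c h)
  descend : ∀ b → (∀ {b′} → b′ < b → Goal b′) → Goal b
  descend _ smaller f refl p with any-sub? (λ eq (q , lt) → P-cong eq q , subst (_< c f) (c-cong eq) lt)
                                        (λ g → P? g ×-dec c g <? c f)
  ... | yes (g , q , lt) = smaller lt g refl q
  ... | no none = f , p , λ h q → ≮⇒≥ λ lt → none (h , q , lt)

-- Walks, components and boundaries

module _ (G : Graph) where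

  private
    V = Fin (n G)
    E = Fin (m G)

  joins-sym : ∀ {i u w} → Joins G i u w → Joins G i w u
  joins-sym (inj₁ e) = inj₂ e
  joins-sym (inj₂ e) = inj₁ e

  joins? : ∀ i u w → Dec (Joins G i u w)
  joins? i u w = ≡-dec _≟_ _≟_ (ends G i) (u , w) ⊎-dec ≡-dec _≟_ _≟_ (ends G i) (w , u)

  module _ {A : E → Set} {S : Sub (n G)} where

    source∈ : ∀ {u v} → Walk G A S u v → S u ≡ true
    source∈ (here u∈S) = u∈S
    source∈ (step _ _ _ u∈S _) = u∈S

    target∈ : ∀ {u v} → Walk G A S u v → S v ≡ true
    target∈ (here v∈S) = v∈S
    target∈ (step _ _ _ _ W) = target∈ W

    walk-snoc : ∀ {x u w} i → Walk G A S x u → A i → Joins G i u w → S w ≡ true → Walk G A S x w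
    walk-snoc i (here u∈S) a J w∈S = step i a J u∈S (here w∈S)
    walk-snoc i (step i′ a′ J′ x∈S W) a J w∈S = step i′ a′ J′ x∈S (walk-snoc i W a J w∈S)

    walk-trans : ∀ {u v w} → Walk G A S u v → Walk G A S v w → Walk G A S u w
    walk-trans (here _) W′ = W′
    walk-trans (step i a J u∈S W) W′ = step i a J u∈S (walk-trans W W′)

    walk-sym : ∀ {u v} → Walk G A S u v → Walk G A S v u
    walk-sym (here u∈S) = here u∈S
    walk-sym (step i a J u∈S W) = walk-snoc i (walk-sym W) a (joins-sym J) u∈S

  walk-restrict : ∀ {A : E → Set} {S S′ : Sub (n G)} {u v} → S ⊆ S′ → Walk G A S u v → Walk G A S′ u v
  walk-restrict S⊆S′ (here u∈S) = here (S⊆S′ _ u∈S)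
  walk-restrict S⊆S′ (step i a J u∈S W) = step i a J (S⊆S′ _ u∈S) (walk-restrict S⊆S′ W)

  connected-via : ∀ {S : Sub (n G)} h → S h ≡ true → (∀ x → S x ≡ true → Walk G (AllEdges G) S x h) →
                  ConnectedSet G S
  connected-via h h∈S to-h = (h , h∈S) , λ u v u∈S v∈S → walk-trans (to-h u u∈S) (walk-sym (to-h v v∈S))

  connected-cong : ConnectedSet G Respects _≗_
  connected-cong S≗S′ ((h , h∈S) , walks) =
    (h , trans (sym (S≗S′ h)) h∈S) ,
    λ u v u∈S′ v∈S′ → walk-restrict (λ x → trans (sym (S≗S′ x)))
                                    (walks u v (trans (S≗S′ u) u∈S′) (trans (S≗S′ v) v∈S′))

  Exit : (A : E → Set) → Sub (n G) → V → V → Set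
  Exit A S u v = ∃ λ i → A i × ∃ λ w → Joins G i u w × Walk G A (remove S u) w v

  last-visit : ∀ {A S} u {x v} → Walk G A S x v → Walk G A (remove S u) x v ⊎ u ≡ v ⊎ Exit A S u v
  last-visit {S = S} u {x} (here x∈S) with x ≟ u
  ... | yes refl = inj₂ (inj₁ refl)
  ... | no x≢u = inj₁ (here (remove-∈ S x∈S x≢u))
  last-visit {S = S} u {x} (step i a J x∈S W) with last-visit u W
  ... | inj₂ later = inj₂ later
  ... | inj₁ W′ with x ≟ u
  ...   | yes refl = inj₂ (inj₂ (i , a , _ , J , W′))
  ...   | no x≢u = inj₁ (step i a J (remove-∈ S x∈S x≢u) W′)

  exit : ∀ {A S u v} → Walk G A S u v → u ≢ v → Exit A S u v
  exit {S = S} {u} W u≢v with last-visit u W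
  ... | inj₁ W′ = clash (source∈ W′) (remove-self S u)
  ... | inj₂ (inj₁ u≡v) = contradiction u≡v u≢v
  ... | inj₂ (inj₂ e) = e

  module _ {A : E → Set} (A? : Decidable A) where

    -- A walk from u to v ≠ u leaves u for the last time along an edge and then stays in S − u.
    walk?-within : ∀ fuel (S : Sub (n G)) → count S ≤ fuel → ∀ u v → Dec (Walk G A S u v)
    walk?-within fuel S _ u v with S u ≟ᴮ true | u ≟ v
    ... | no u∉S | _ = no (u∉S ∘ source∈)
    ... | yes u∈S | yes refl = yes (here u∈S)
    walk?-within zero S bound u v | yes u∈S | no _ =
      contradiction (subst (_≤ 0) (count-remove S u∈S) bound) λ ()
    walk?-within (suc fuel) S bound u v | yes u∈S | no u≢v =
      map′ (λ (i , a , w , J , W) → step i a J u∈S (walk-restrict (remove-⊆ S u) W))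
           (λ W → exit W u≢v)
           (any? λ i → A? i ×-dec any? λ w → joins? i u w ×-dec walk?-within fuel (remove S u) bound′ w v)
      where bound′ = ≤-pred (subst (_≤ suc fuel) (count-remove S u∈S) bound)

    walk? : ∀ S u v → Dec (Walk G A S u v)
    walk? S = walk?-within (n G) S (count≤ S)

    component : Sub (n G) → V → Sub (n G)
    component S y x = does (walk? S y x)

    module _ (S : Sub (n G)) (y : V) where

      walk⇒∈component : ∀ {x} → Walk G A S y x → component S y x ≡ true
      walk⇒∈component {x} = dec-true (walk? S y x)

      ∈component⇒walk : ∀ {x} → component S y x ≡ true → Walk G A S y x
      ∈component⇒walk {x} x∈ with walk? S y x
      ... | yes W = W

      component-⊆ : component S y ⊆ S
      component-⊆ _ = target∈ ∘ ∈component⇒walk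

      component-closed : ∀ {i u w} → A i → Joins G i u w → component S y u ≡ true → S w ≡ true →
                         component S y w ≡ true
      component-closed {i} a J u∈ w∈S = walk⇒∈component (walk-snoc i (∈component⇒walk u∈) a J w∈S)

      walk-in-component : ∀ {u v} → Walk G A S y u → Walk G A S u v → Walk G (AllEdges G) (component S y) u v
      walk-in-component Wyu (here _) = here (walk⇒∈component Wyu)
      walk-in-component Wyu (step i a J _ W) =
        step i tt J (walk⇒∈component Wyu) (walk-in-component (walk-snoc i Wyu a J (source∈ W)) W)

      component-connected : S y ≡ true → ConnectedSet G (component S y)
      component-connected y∈S = connected-via y (walk⇒∈component (here y∈S)) λ x x∈ →
        let W = ∈component⇒walk x∈ in walk-in-component W (walk-sym W)

      component-leaves : ∀ {i u w} → A i → Joins G i u w →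
                         component S y u ≡ true → component S y w ≡ false → S u xor S w ≡ true
      component-leaves {w = w} a J u∈ w∉ with S w in w∈S
      ... | true = clash (component-closed a J u∈ w∈S) w∉
      ... | false rewrite component-⊆ _ u∈ = refl

  boundary : Sub (n G) → Sub (m G)
  boundary D i = D (proj₁ (ends G i)) xor D (proj₂ (ends G i))

  boundary-joins : ∀ D {i u w} → Joins G i u w → boundary D i ≡ D u xor D w
  boundary-joins D (inj₁ refl) = refl
  boundary-joins D {u = u} {w} (inj₂ refl) = xor-comm (D w) (D u)

  boundary-complement : ∀ D → boundary (complement D) ≗ boundary D
  boundary-complement D i
    rewrite complement-not D (proj₁ (ends G i)) | complement-not D (proj₂ (ends G i))
    with D (proj₁ (ends G i)) | D (proj₂ (ends G i))
  ... | true | true = refl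
  ... | true | false = refl
  ... | false | true = refl
  ... | false | false = refl

  component-boundary : ∀ {A : E → Set} (A? : Decidable A) S y i → A i →
                       boundary (component A? S y) i ≡ true → boundary S i ≡ true
  component-boundary A? S y i a crosses with xor-true crosses
  ... | inj₁ (u∈ , w∉) = component-leaves A? S y a (inj₁ refl) u∈ w∉
  ... | inj₂ (u∉ , w∈) = trans (xor-comm (S (proj₁ (ends G i))) _) (component-leaves A? S y a (inj₂ refl) w∈ u∉)

  walk-leaves : ∀ {A : E → Set} {C S : Sub (n G)} {s x} → Walk G A C s x → S s ≡ true → S x ≡ false →
                ∃ λ i → ∃ λ a → ∃ λ b → Joins G i a b × S a ≡ true × S b ≡ false × C b ≡ true
  walk-leaves (here _) s∈S x∉S = clash s∈S x∉S
  walk-leaves {S = S} (step {w = w} i _ J _ W) s∈S x∉S with S w in w∈S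
  ... | true = walk-leaves W w∈S x∉S
  ... | false = i , _ , w , J , s∈S , w∈S , source∈ W

  singleton-connected : ∀ b → ConnectedSet G (singleton b)
  singleton-connected b = connected-via b b∈ λ x x∈ →
    subst (λ z → Walk G _ _ z b) (sym (singleton-∈ x∈)) (here b∈)
    where b∈ = insert-self empty b

  insert-connected : ∀ {S i a b} → ConnectedSet G S → Joins G i a b → S a ≡ true → ConnectedSet G (insert S b)
  insert-connected {S} {i} {a} {b} ((h , h∈S) , walks) J a∈S =
    connected-via h (insert-⊇ S b h h∈S) to-h
    where
    to-h : ∀ x → insert S b x ≡ true → Walk G (AllEdges G) (insert S b) x h
    to-h x x∈ with insert-∈ S b x∈
    ... | inj₁ x∈S = walk-restrict (insert-⊇ S b) (walks x h x∈S h∈S)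
    ... | inj₂ refl = step i tt (joins-sym J) x∈ (walk-restrict (insert-⊇ S b) (walks a h a∈S h∈S))

  HasEgg : ℕ → Sub (n G) → Set
  HasEgg k D = Σ (Sub (n G)) λ S → EggE G k S × S ⊆ D

  connected-has-egg : ∀ {C} → ConnectedSet G C → ∀ j → suc j ≤ count C → HasEgg (suc j) C
  connected-has-egg {C} ((c , c∈C) , _) zero _ =
    singleton c , (singleton-connected c , count-singleton c) , insert-⊆ (λ _ ()) c∈C
  connected-has-egg {C} C-conn@(_ , walks) (suc j) bound
    with connected-has-egg C-conn j (<⇒≤ bound)
  ... | S , (S-conn@((s , s∈S) , _) , |S|) , S⊆C
    with count<⇒∃ S C (subst (_< count C) (sym |S|) bound)
  ... | x , x∈C , x∉S
    with walk-leaves (walks s x (S⊆C s s∈S) x∈C) s∈S x∉S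
  ... | i , a , b , J , a∈S , b∉S , b∈C =
    insert S b , (insert-connected S-conn J a∈S , trans (count-insert S b∉S) (cong suc |S|)) , insert-⊆ S⊆C b∈C

  allEdges? : Decidable (AllEdges G)
  allEdges? _ = yes tt

  kept? : ∀ T → Decidable (Kept G T)
  kept? T i = T i ≟ᴮ false

  connected⊆component : ∀ {S X y} → ConnectedSet G S → S ⊆ X → S y ≡ true → S ⊆ component allEdges? X y
  connected⊆component {X = X} {y} (_ , walks) S⊆X y∈S x x∈S =
    walk⇒∈component allEdges? X y (walk-restrict S⊆X (walks y x y∈S x∈S))

  cut-component≤ : ∀ S y → cutSize G (component allEdges? S y) ≤ cutSize G S
  cut-component≤ S y = count-mono λ i → component-boundary allEdges? S y i tt

  cut-complement : ∀ D → cutSize G (complement D) ≡ cutSize G D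
  cut-complement D = count-cong (boundary-complement D)

  cut-cong : ∀ {D D′} → D ≗ D′ → cutSize G D ≡ cutSize G D′
  cut-cong eq = count-cong λ i → cong₂ _xor_ (eq (proj₁ (ends G i))) (eq (proj₂ (ends G i)))

  component-boundary⊆ : ∀ T u → boundary (component (kept? T) (AllVerts G) u) ⊆ T
  component-boundary⊆ T u i crosses with T i in e
  ... | true = refl
  ... | false = contradiction (component-boundary (kept? T) (AllVerts G) u i e crosses) λ ()

  ⊆complement-component : ∀ C y → C ⊆ complement (component allEdges? (complement C) y)
  ⊆complement-component C y = disjoint⇒⊆complement λ x x∈C x∈D →
    clash x∈C (∈complement⇒∉ {D = C} (component-⊆ allEdges? (complement C) y x x∈D))

  complement-component-connected : ConnectedGraph G → ∀ {C} → ConnectedSet G C → ∀ y →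
                                   ConnectedSet G (complement (component allEdges? (complement C) y))
  complement-component-connected (_ , conn) {C} ((c , c∈C) , C-walks) y =
    connected-via c (C⊆Dᶜ c c∈C) λ x x∈Dᶜ → toward-C (conn x c) (∈complement⇒∉ {D = D} x∈Dᶜ)
    where
    D = component allEdges? (complement C) y
    C⊆Dᶜ = ⊆complement-component C y
    -- Outside C, a walk towards c never steps into D, since D is closed under edges within Cᶜ.
    toward-C : ∀ {x} → Walk G (AllEdges G) (AllVerts G) x c → D x ≡ false → Walk G (AllEdges G) (complement D) x c
    toward-C (here _) x∉D = here (∉⇒∈complement {D = D} x∉D)
    toward-C {x} (step {w = w} i _ J _ W) x∉D with C x in x∈C
    ... | true = walk-restrict C⊆Dᶜ (C-walks x c x∈C c∈C)
    ... | false with D w in w∈D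
    ...   | true = clash (component-closed allEdges? (complement C) y tt (joins-sym J) w∈D x∈Cᶜ) x∉D
      where x∈Cᶜ = ∉⇒∈complement {D = C} x∈C
    ...   | false = step i tt J (∉⇒∈complement {D = D} x∉D) (toward-C W w∈D)

  -- Egg bonds

  EggBond : ℕ → Sub (n G) → Set
  EggBond k D = ConnectedSet G D × ConnectedSet G (complement D) × HasEgg k D × HasEgg k (complement D)

  BondBelow : ℕ → ℕ → Set
  BondBelow k s = Σ (Sub (n G)) λ D → EggBond k D × cutSize G D ≤ s

  bond⇒eggCut : ∀ {k D} → EggBond k D → EggCutOfSize G (EggE G k) (cutSize G D)
  bond⇒eggCut {D = D} (_ , _ , egg , eggᶜ) = D , (egg , eggᶜ) , refl

  walk-avoids-boundary : ∀ {X} D → (∀ {a b} → X a ≡ true → X b ≡ true → D a ≡ D b) → ∀ {u v} →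
                         Walk G (AllEdges G) X u v → Walk G (Kept G (boundary D)) (AllVerts G) u v
  walk-avoids-boundary D D-const (here _) = here refl
  walk-avoids-boundary D D-const (step {w = w} i _ J u∈X W) =
    step i (trans (boundary-joins D J) (trans (cong (_xor D w) (D-const u∈X (source∈ W))) (xor-same (D w))))
         J refl (walk-avoids-boundary D D-const W)

  boundary-walk-preserves : ∀ D {S u v} → Walk G (Kept G (boundary D)) S u v → D u ≡ D v
  boundary-walk-preserves D (here _) = refl
  boundary-walk-preserves D (step i kept J _ W) =
    trans (xor-false (trans (sym (boundary-joins D J)) kept)) (boundary-walk-preserves D W)

  bond⇒kCut : ∀ {k D} → EggBond k D → KCutOfSize G k (cutSize G D)
  bond⇒kCut {k} {D} (((u , u∈D) , walks) , ((v , v∈Dᶜ) , walksᶜ) ,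
                     (S , (_ , |S|) , S⊆D) , (S′ , (_ , |S′|) , S′⊆Dᶜ)) =
    boundary D , (separated , reaches-k) , refl
    where
    separated = u , v , λ W → clash u∈D (trans (boundary-walk-preserves D W) (∈complement⇒∉ {D = D} v∈Dᶜ))
    reaches-k : ∀ x → Σ (Fin k → V) λ f → Injective _≡_ _≡_ f ×
                                         (∀ j → Walk G (Kept G (boundary D)) (AllVerts G) x (f j))
    reaches-k x with D x in x∈D
    ... | true = count⇒injection |S| λ y y∈S →
          walk-avoids-boundary D (λ a∈ b∈ → trans a∈ (sym b∈)) (walks x y x∈D (S⊆D y y∈S))
    ... | false = count⇒injection |S′| λ y y∈S′ →
          walk-avoids-boundary D (λ a∈ b∈ → trans (∈complement⇒∉ {D = D} a∈) (sym (∈complement⇒∉ {D = D} b∈)))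
            (walksᶜ x y (∉⇒∈complement {D = D} x∈D) (S′⊆Dᶜ y y∈S′))

  connected-eggCut⇒bond : ConnectedGraph G → ∀ {k C} → ConnectedSet G C →
                          HasEgg k C → HasEgg k (complement C) → BondBelow k (cutSize G C)
  connected-eggCut⇒bond conn {C = C} C-conn (S , S-egg , S⊆C)
                        (S′ , S′-egg@(S′-conn@((y , y∈S′) , _) , _) , S′⊆Cᶜ) =
    D ,
    (component-connected allEdges? (complement C) y (S′⊆Cᶜ y y∈S′) ,
     complement-component-connected conn C-conn y ,
     (S′ , S′-egg , connected⊆component S′-conn S′⊆Cᶜ y∈S′) ,
     (S , S-egg , λ x x∈S → ⊆complement-component C y x (S⊆C x x∈S))) ,
    ≤-trans (cut-component≤ (complement C) y) (≤-reflexive (cut-complement C))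
    where
    D = component allEdges? (complement C) y

  eggCut⇒bond : ConnectedGraph G → ∀ {k s} → EggCutOfSize G (EggE G k) s → BondBelow k s
  eggCut⇒bond conn (A , ((S , S-egg@(S-conn@((p , p∈S) , _) , _) , S⊆A) , (S′ , S′-egg , S′⊆Aᶜ)) , refl)
    with connected-eggCut⇒bond conn (component-connected allEdges? A p (S⊆A p p∈S))
           (S , S-egg , connected⊆component S-conn S⊆A p∈S)
           (S′ , S′-egg , disjoint⇒⊆complement λ x x∈S′ x∈C →
              clash (component-⊆ allEdges? A p x x∈C) (∈complement⇒∉ {D = A} (S′⊆Aᶜ x x∈S′)))
  ... | D , D-bond , cut≤ = D , D-bond , ≤-trans cut≤ (cut-component≤ A p)

  kCut⇒eggCut : ∀ {k T} → 1 ≤ k → IsKCut G k T →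
                Σ (Sub (n G)) λ A → IsEggCut G (EggE G k) A × cutSize G A ≤ count T
  kCut⇒eggCut {suc j} {T} (s≤s z≤n) ((u , v , ¬u⇝v) , reaches) =
    Cu , (egg-in u , Cv-egg-in-Cuᶜ) , count-mono (component-boundary⊆ T u)
    where
    C : V → Sub (n G)
    C = component (kept? T) (AllVerts G)
    egg-in : ∀ x → HasEgg (suc j) (C x)
    egg-in x with reaches x
    ... | f , f-inj , f-reached =
      connected-has-egg (component-connected (kept? T) (AllVerts G) x refl) j
        (injection≤count (C x) f f-inj (walk⇒∈component (kept? T) (AllVerts G) x ∘ f-reached))
    Cu = C u
    Cv-egg-in-Cuᶜ : HasEgg (suc j) (complement Cu)
    Cv-egg-in-Cuᶜ with egg-in v
    ... | S , S-egg , S⊆Cv = S , S-egg , disjoint⇒⊆complement λ x x∈S x∈Cu →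
      ¬u⇝v (walk-trans (∈component⇒walk (kept? T) (AllVerts G) u x∈Cu)
                       (walk-sym (∈component⇒walk (kept? T) (AllVerts G) v (S⊆Cv x x∈S))))

  kCut⇒bond : ConnectedGraph G → ∀ {k s} → 1 ≤ k → KCutOfSize G k s → BondBelow k s
  kCut⇒bond conn k≥1 (T , T-cut , refl) with kCut⇒eggCut k≥1 T-cut
  ... | A , A-cut , cut≤ with eggCut⇒bond conn (A , A-cut , refl)
  ... | D , D-bond , cut≤′ = D , D-bond , ≤-trans cut≤′ cut≤

  connected? : Decidable (ConnectedSet G)
  connected? S = any? (λ v → S v ≟ᴮ true) ×-dec
                 all? λ u → all? λ v → (S u ≟ᴮ true) →-dec (S v ≟ᴮ true) →-dec walk? allEdges? S u v

  egg-cong : ∀ {k} → EggE G k Respects _≗_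
  egg-cong eq (S-conn , |S|) = connected-cong eq S-conn , trans (sym (count-cong eq)) |S|

  hasEgg-cong : ∀ {k} → HasEgg k Respects _≗_
  hasEgg-cong eq (S , S-egg , S⊆D) = S , S-egg , λ x x∈S → trans (sym (eq x)) (S⊆D x x∈S)

  hasEgg? : ∀ k → Decidable (HasEgg k)
  hasEgg? k D =
    any-sub? (λ eq (S-egg , S⊆D) → egg-cong eq S-egg , λ x x∈ → S⊆D x (trans (eq x) x∈))
             (λ S → (connected? S ×-dec count S ≟ℕ k) ×-dec all? λ x → (S x ≟ᴮ true) →-dec (D x ≟ᴮ true))

  bond-cong : ∀ {k} → EggBond k Respects _≗_
  bond-cong eq (D-conn , Dᶜ-conn , egg , eggᶜ) =
    connected-cong eq D-conn , connected-cong (complement-cong eq) Dᶜ-conn ,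
    hasEgg-cong eq egg , hasEgg-cong (complement-cong eq) eggᶜ

  bond? : ∀ k → Decidable (EggBond k)
  bond? k D = connected? D ×-dec connected? (complement D) ×-dec hasEgg? k D ×-dec hasEgg? k (complement D)

lemma3p1 : (G : Graph) → ConnectedGraph G → (k : ℕ) → k ≥ 1 →
    Σ (Maybe ℕ) (λ v → IsEggCutNumber G (EggE G k) v × IsLambda G k v)
lemma3p1 G conn k k≥1 with any-sub? (bond-cong G) (bond? G k)
... | no ∄bond = nothing , (λ _ → none ∘ eggCut⇒bond G conn) , (λ _ → none ∘ kCut⇒bond G conn k≥1)
  where
  none : ∀ {s} → ¬ BondBelow G k s
  none (D , D-bond , _) = ∄bond (D , D-bond)
... | yes bond with minimise (bond-cong G) (bond? G k) (cutSize G) (cut-cong G) bond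
... | D , D-bond , D-min =
  just (cutSize G D) ,
  (bond⇒eggCut G D-bond , λ _ → D-below ∘ eggCut⇒bond G conn) ,
  (bond⇒kCut G D-bond , λ _ → D-below ∘ kCut⇒bond G conn k≥1)
  where
  D-below : ∀ {s} → BondBelow G k s → cutSize G D ≤ s
  D-below (D′ , D′-bond , cut≤) = ≤-trans (D-min D′ D′-bond) cut≤
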